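{- Let $n\ge 2$. There is a constant $C>0$ depending only on $n$ such that for every prime power $q$ and all pairwise skew $(n-1)$-spaces $A_1,\ldots,A_{n+1}$ of $\mathrm{PG}(2n,q)$, the number of $n$-spaces of $\mathrm{PG}(2n,q)$ that intersect every $A_i$, $1\le i\le n+1$, is at most $Cq^{n^2-1}$.
   Context: $\mathrm{PG}(2n,q)$ is the projective space of projective dimension $2n$ over $\mathbb{F}_q$; an $i$-space is a subspace of projective dimension $i$; skew means having empty intersection. (The paper states the bound as $\mathcal{O}(q^{n^2-1})$.) -}

module Defs where

open import Level using (0ℓ)
open import Algebra.Bundles using (CommutativeRing)
open import Data.Nat using (ℕ; suc)
open import Data.Fin using (Fin)
open import Data.Product using (Σ; ∃; _×_)
open import Relation.Nullary using (¬_)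
open import Relation.Binary.PropositionalEquality using (_≡_)
import Algebra.Properties.Monoid.Sum as MonoidSum

-- Its order `size` is q; every finite field has prime-power order and
-- for every prime power q there is one, so quantifying over all
-- FiniteFields quantifies over all F_q, q a prime power.
record FiniteField : Set₁ where
  field
    commRing : CommutativeRing 0ℓ 0ℓ
  open CommutativeRing commRing public
  field
    0≉1     : ¬ (0# ≈ 1#)
    inverse : ∀ x → ¬ (x ≈ 0#) → ∃ λ y → (x * y) ≈ 1#
    size    : ℕ
    enum    : Fin size → Carrier
    enum-surjective : ∀ x → ∃ λ i → enum i ≈ x
    enum-injective  : ∀ i j → enum i ≈ enum j → i ≡ j

module _ (F : FiniteField) where
  open FiniteField F
  open MonoidSum +-monoid using (sum)

  Vect : ℕ → Set
  Vect m = Fin m → Carrier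

  IsZero : ∀ {m} → Vect m → Set
  IsZero v = ∀ j → v j ≈ 0#

  lincomb : ∀ {m r} → (Fin r → Vect m) → (Fin r → Carrier) → Vect m
  lincomb {r = r} B c j = sum {r} (λ i → c i * B i j)

  InSpan : ∀ {m r} → (Fin r → Vect m) → Vect m → Set
  InSpan B v = ∃ λ c → ∀ j → v j ≈ lincomb B c j

  LinIndep : ∀ {m r} → (Fin r → Vect m) → Set
  LinIndep B = ∀ c → IsZero (lincomb B c) → ∀ i → c i ≈ 0#

  record Subspace (m r : ℕ) : Set where
    constructor subspace
    field
      basis  : Fin r → Vect m
      indep  : LinIndep basis
  open Subspace public

  _∈_ : ∀ {m r} → Vect m → Subspace m r → Set
  v ∈ S = InSpan (basis S) v

  -- an i-space of PG(d,q): a vector subspace of F_q^(d+1) of dimension i+1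
  ProjSubspace : (d i : ℕ) → Set
  ProjSubspace d i = Subspace (suc d) (suc i)

  SameSpace : ∀ {m r s} → Subspace m r → Subspace m s → Set
  SameSpace S T = ∀ v → (v ∈ S → v ∈ T) × (v ∈ T → v ∈ S)

  -- projective subspaces intersect iff they share a nonzero vector
  Meets : ∀ {m r s} → Subspace m r → Subspace m s → Set
  Meets S T = ∃ λ v → ¬ IsZero v × v ∈ S × v ∈ T

  Skew : ∀ {m r s} → Subspace m r → Subspace m s → Set
  Skew S T = ¬ Meets S T

{-# OPTIONS --safe #-}
-- Pick a point pᵢ ∈ S ∩ Aᵢ on each of the n + 1 subspaces, in coordinates normalised
-- to cost n − 1 field elements.  If the pᵢ are independent they form a basis of S, which
-- is thus recorded by (n + 1)(n − 1) = n² − 1 field elements.  Otherwise some pⱼ is a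
-- combination of independent points p_σ; as Aⱼ is skew to each A_{σ s}, at least two
-- coefficients are nonzero.  Replacing one of these points by the multiple y ∈ A_{σ s}
-- with y + (the rest) ∈ Aⱼ, y need not be recorded: it is unique because A_{σ s} ∩ Aⱼ = 0.
-- Completing to a basis of S by vectors in reduced echelon form (at most n field elements
-- each) again costs at most n² − 1 field elements in total, plus boundedly many discrete
-- choices.  Distinct n-spaces get distinct codes, whence at most C q^(n² − 1) of them.
module Submission where

open import Defs
open import Data.Nat as ℕ using (ℕ; zero; suc; z≤n; s≤s)
import Data.Nat.Properties as ℕₚ
open import Data.Nat.Solver using (module +-*-Solver)
open import Data.Fin as Fin using (Fin; zero; suc; punchIn; _↑ˡ_; _↑ʳ_; splitAt; funToFin; finToFun)
import Data.Fin.Properties as Finₚ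
open import Data.Vec.Functional using ([]; _∷_; _++_; take; drop; tail; insertAt; removeAt)
import Data.Vec.Functional.Properties as Vecₚ
open import Data.Product using (Σ; ∃; _×_; _,_; proj₁; proj₂; swap)
open import Data.Sum using (_⊎_; inj₁; inj₂)
open import Data.Sum.Properties using ([,]-map; [,]-∘)
open import Data.Empty using (⊥; ⊥-elim)
open import Relation.Nullary using (¬_; Dec; yes; no)
import Relation.Nullary.Decidable as Dec
open import Relation.Nullary.Decidable using (¬?)
open import Relation.Binary.Definitions using (tri<; tri≈; tri>)
open import Relation.Binary.PropositionalEquality as ≡ using (_≡_; _≢_; _≗_)
open import Function using (_∘_)
open import Data.List as List using (List; length)
import Data.List.Relation.Unary.All as All
open import Data.List.Relation.Unary.AllPairs as AllPairs using (AllPairs)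
open import Data.List.Membership.Propositional.Properties using (∈-lookup)

++-∷ : ∀ {A : Set} {k b} (C : Fin (suc k) → A) (B : Fin b → A) → C ++ B ≗ C zero ∷ (tail C ++ B)
++-∷ C B zero = ≡.refl
++-∷ {k = k} C B (suc i) = [,]-map (splitAt k i)

take++drop : ∀ {A : Set} k {b} (e : Fin (k ℕ.+ b) → A) → e ≗ take k e ++ drop k e
take++drop k {b} e i = ≡.trans (≡.cong e (≡.sym (Finₚ.join-splitAt k b i))) ([,]-∘ e (splitAt k i))

funToFin-cong : ∀ {a b} {f g : Fin a → Fin b} → f ≗ g → funToFin f ≡ funToFin g
funToFin-cong {zero} f≗g = ≡.refl
funToFin-cong {suc a} f≗g = ≡.cong₂ Fin.combine (f≗g zero) (funToFin-cong (f≗g ∘ suc))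

funToFin-injective : ∀ {a b} {f g : Fin a → Fin b} → funToFin f ≡ funToFin g → f ≗ g
funToFin-injective {f = f} {g} eq x = ≡.trans (≡.sym (Finₚ.finToFun-funToFin f x))
  (≡.trans (≡.cong (λ i → finToFun i x) eq) (Finₚ.finToFun-funToFin g x))

↑ˡ≢↑ʳ : ∀ {a b} (i : Fin a) (j : Fin b) → i ↑ˡ b ≢ a ↑ʳ j
↑ˡ≢↑ʳ {a} {b} i j eq with ≡.trans (≡.sym (Finₚ.splitAt-↑ˡ a i b)) (≡.trans (≡.cong (splitAt a) eq) (Finₚ.splitAt-↑ʳ a b j))
... | ()

^-cancelʳ-≤ : ∀ q {u b} → 1 ℕ.< q → q ℕ.^ u ℕ.≤ q ℕ.^ b → u ℕ.≤ b
^-cancelʳ-≤ q 1<q q^u≤q^b = ℕₚ.≮⇒≥ (λ b<u → ℕₚ.<⇒≱ (ℕₚ.^-monoʳ-< q 1<q b<u) q^u≤q^b)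

++-pointwise : ∀ {A : Set} (R : A → A → Set) {k b} {C C′ : Fin k → A} {B B′ : Fin b → A} →
               (∀ i → R (C i) (C′ i)) → (∀ i → R (B i) (B′ i)) → ∀ i → R ((C ++ B) i) ((C′ ++ B′) i)
++-pointwise R {k} CRC′ BRB′ i with splitAt k i
... | inj₁ i′ = CRC′ i′
... | inj₂ i′ = BRB′ i′

++-All : ∀ {A : Set} (P : A → Set) {k b} {C : Fin k → A} {B : Fin b → A} →
         (∀ i → P (C i)) → (∀ i → P (B i)) → ∀ i → P ((C ++ B) i)
++-All P {k} PC PB i with splitAt k i
... | inj₁ i′ = PC i′
... | inj₂ i′ = PB i′

AllPairs-lookup : ∀ {A : Set} {R : A → A → Set} {xs : List A} → AllPairs R xs →
                  ∀ {i j} → i Fin.< j → R (List.lookup xs i) (List.lookup xs j)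
AllPairs-lookup (Rx∷xs AllPairs.∷ _) {zero} {suc j} _ = All.lookup Rx∷xs (∈-lookup j)
AllPairs-lookup (_ AllPairs.∷ Rxs) {suc i} {suc j} (s≤s i<j) = AllPairs-lookup Rxs i<j

module LinearAlgebra (F : FiniteField) where
  open FiniteField F hiding (zero)
  open import Algebra.Properties.Ring ring using (-1*x≈-x; -‿distribˡ-*; -‿distribʳ-*; x[y-z]≈xy-xz; -0#≈0#)
  open import Algebra.Properties.AbelianGroup +-abelianGroup
    using (xyx⁻¹≈y; inverseˡ-unique; x∙y⁻¹≈ε⇒x≈y; ⁻¹-anti-homo‿-; ⁻¹-∙-comm)
  open import Algebra.Solver.CommutativeMonoid +-commutativeMonoid using (solve; _⊕_; _⊜_)
  open import Algebra.Properties.Semiring.Sum semiring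
    using (sum; sum-cong-≋; sum-remove; sum-replicate-zero; ∑-distrib-+; ∑-comm; *-distribˡ-sum; *-distribʳ-sum)
  open import Relation.Binary.Reasoning.Setoid setoid

  index : Carrier → Fin size
  index x = proj₁ (enum-surjective x)

  enum-index : ∀ x → enum (index x) ≈ x
  enum-index x = proj₂ (enum-surjective x)

  index-injective : ∀ {x y} → index x ≡ index y → x ≈ y
  index-injective {x} {y} e = trans (sym (enum-index x)) (trans (reflexive (≡.cong enum e)) (enum-index y))

  infix 4 _≈?_
  _≈?_ : ∀ x y → Dec (x ≈ y)
  x ≈? y = Dec.map′ index-injective index-cong (index x Fin.≟ index y)
    where
    index-cong : x ≈ y → index x ≡ index y
    index-cong x≈y = enum-injective _ _ (trans (enum-index x) (trans x≈y (sym (enum-index y))))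

  1<size : 1 ℕ.< size
  1<size = Finₚ.injective⇒≤ {f = index ∘ (0# ∷ 1# ∷ [])} injective
    where
    injective : ∀ {i j} → index ((0# ∷ 1# ∷ []) i) ≡ index ((0# ∷ 1# ∷ []) j) → i ≡ j
    injective {zero} {zero} _ = ≡.refl
    injective {zero} {suc zero} e = ⊥-elim (0≉1 (index-injective e))
    injective {suc zero} {zero} e = ⊥-elim (0≉1 (index-injective (≡.sym e)))
    injective {suc zero} {suc zero} _ = ≡.refl

  inv : ∀ x → x ≉ 0# → Carrier
  inv x x≉0 = proj₁ (inverse x x≉0)

  *-inverseˡ : ∀ x (x≉0 : x ≉ 0#) → inv x x≉0 * x ≈ 1#
  *-inverseˡ x x≉0 = trans (*-comm _ _) (proj₂ (inverse x x≉0))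

  x*y≈0⇒y≈0 : ∀ {x y} → x ≉ 0# → x * y ≈ 0# → y ≈ 0#
  x*y≈0⇒y≈0 {x} {y} x≉0 xy≈0 = begin
    y                    ≈⟨ *-identityˡ y ⟨
    1# * y               ≈⟨ *-congʳ (*-inverseˡ x x≉0) ⟨
    inv x x≉0 * x * y    ≈⟨ *-assoc _ _ _ ⟩
    inv x x≉0 * (x * y)  ≈⟨ *-congˡ xy≈0 ⟩
    inv x x≉0 * 0#       ≈⟨ zeroʳ _ ⟩
    0#                   ∎

  x*y≉0 : ∀ {x y} → x ≉ 0# → y ≉ 0# → x * y ≉ 0#
  x*y≉0 x≉0 y≉0 xy≈0 = y≉0 (x*y≈0⇒y≈0 x≉0 xy≈0)

  inv≉0 : ∀ x (x≉0 : x ≉ 0#) → inv x x≉0 ≉ 0#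
  inv≉0 x x≉0 inv≈0 = 0≉1 (trans (sym (zeroˡ x)) (trans (*-congʳ (sym inv≈0)) (*-inverseˡ x x≉0)))

  x-[x-y]≈y : ∀ x y → x - (x - y) ≈ y
  x-[x-y]≈y x y = begin
    x - (x - y)   ≈⟨ +-congˡ (⁻¹-anti-homo‿- x y) ⟩
    x + (y - x)   ≈⟨ +-assoc x y (- x) ⟨
    x + y - x     ≈⟨ xyx⁻¹≈y x y ⟩
    y             ∎

  [x+z]-[y+z]≈x-y : ∀ x y z → (x + z) - (y + z) ≈ x - y
  [x+z]-[y+z]≈x-y x y z = begin
    (x + z) - (y + z)      ≈⟨ +-congˡ (⁻¹-∙-comm y z) ⟨
    (x + z) + (- y + - z)  ≈⟨ solve 4 (λ x z y′ z′ → (x ⊕ z) ⊕ (y′ ⊕ z′) ⊜ (x ⊕ y′) ⊕ (z ⊕ z′)) refl x z (- y) (- z) ⟩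
    (x - y) + (z - z)      ≈⟨ +-congˡ (-‿inverseʳ z) ⟩
    (x - y) + 0#           ≈⟨ +-identityʳ _ ⟩
    x - y                  ∎

  V : ℕ → Set
  V = Vect F

  infix 4 _≋_
  _≋_ : ∀ {m} → V m → V m → Set
  u ≋ v = ∀ j → u j ≈ v j

  infixl 6 _⊞_ _⊟_
  infixr 7 _⊙_

  _⊞_ : ∀ {m} → V m → V m → V m
  (u ⊞ v) j = u j + v j

  _⊟_ : ∀ {m} → V m → V m → V m
  (u ⊟ v) j = u j - v j

  _⊙_ : ∀ {m} → Carrier → V m → V m
  (a ⊙ v) j = a * v j

  IsZero? : ∀ {m} (v : V m) → Dec (IsZero F v)
  IsZero? v = Finₚ.all? (λ j → v j ≈? 0#)

  nonzero-entry : ∀ {r} (c : Fin r → Carrier) → ¬ (∀ i → c i ≈ 0#) → ∃ λ i → c i ≉ 0#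
  nonzero-entry c = Finₚ.¬∀⟶∃¬ _ _ (λ i → c i ≈? 0#)

  δ : ∀ {m} → Fin m → Fin m → Carrier
  δ i j with i Fin.≟ j
  ... | yes _ = 1#
  ... | no  _ = 0#

  δ-diag : ∀ {m} (i : Fin m) → δ i i ≈ 1#
  δ-diag i with i Fin.≟ i
  ... | yes _  = refl
  ... | no i≢i = ⊥-elim (i≢i ≡.refl)

  δ-offdiag : ∀ {m} {i j : Fin m} → i ≢ j → δ i j ≈ 0#
  δ-offdiag {i = i} {j} i≢j with i Fin.≟ j
  ... | yes i≡j = ⊥-elim (i≢j i≡j)
  ... | no  _   = refl

  sum-δ : ∀ {r} (g : Fin (suc r) → Carrier) i → sum (λ k → δ k i * g k) ≈ g i
  sum-δ {r} g i = begin
    sum (λ k → δ k i * g k)                             ≈⟨ sum-remove {i = i} (λ k → δ k i * g k) ⟩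
    δ i i * g i + sum (removeAt (λ k → δ k i * g k) i)
      ≈⟨ +-cong (trans (*-congʳ (δ-diag i)) (*-identityˡ _))
                (trans (sum-cong-≋ {r} (λ k → trans (*-congʳ (δ-offdiag (Finₚ.punchInᵢ≢i i k))) (zeroˡ _)))
                       (sum-replicate-zero r)) ⟩
    g i + 0#                                            ≈⟨ +-identityʳ _ ⟩
    g i                                                 ∎

  lincomb-cong : ∀ {m r} {B B′ : Fin r → V m} {c c′ : Fin r → Carrier} →
                 (∀ i → B i ≋ B′ i) → (∀ i → c i ≈ c′ i) → lincomb F B c ≋ lincomb F B′ c′
  lincomb-cong {r = r} B≋B′ c≈c′ j = sum-cong-≋ {r} (λ i → *-cong (c≈c′ i) (B≋B′ i j))

  lincomb-congʳ : ∀ {m r} (B : Fin r → V m) {c c′ : Fin r → Carrier} →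
                  (∀ i → c i ≈ c′ i) → lincomb F B c ≋ lincomb F B c′
  lincomb-congʳ B = lincomb-cong (λ i j → refl)

  lincomb-zero : ∀ {m r} (B : Fin r → V m) {c} → (∀ i → c i ≈ 0#) → IsZero F (lincomb F B c)
  lincomb-zero {r = r} B c≈0 j =
    trans (sum-cong-≋ {r} (λ i → trans (*-congʳ (c≈0 i)) (zeroˡ (B i j)))) (sum-replicate-zero r)

  lincomb-+ : ∀ {m r} (B : Fin r → V m) c d → lincomb F B (λ i → c i + d i) ≋ lincomb F B c ⊞ lincomb F B d
  lincomb-+ {r = r} B c d j =
    trans (sum-cong-≋ {r} (λ i → distribʳ (B i j) (c i) (d i))) (∑-distrib-+ (λ i → c i * B i j) (λ i → d i * B i j))

  lincomb-scale : ∀ {m r} (B : Fin r → V m) a c → lincomb F B (λ i → a * c i) ≋ a ⊙ lincomb F B c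
  lincomb-scale {r = r} B a c j =
    trans (sum-cong-≋ {r} (λ i → *-assoc a (c i) (B i j))) (sym (*-distribˡ-sum a (λ i → c i * B i j)))

  lincomb-neg : ∀ {m r} (B : Fin r → V m) c j → lincomb F B (λ i → - c i) j ≈ - lincomb F B c j
  lincomb-neg B c j = begin
    lincomb F B (λ i → - c i) j       ≈⟨ lincomb-congʳ B (λ i → -1*x≈-x (c i)) j ⟨
    lincomb F B (λ i → - 1# * c i) j  ≈⟨ lincomb-scale B (- 1#) c j ⟩
    - 1# * lincomb F B c j            ≈⟨ -1*x≈-x _ ⟩
    - lincomb F B c j                 ∎

  lincomb-sub : ∀ {m r} (B : Fin r → V m) c d → lincomb F B (λ i → c i - d i) ≋ lincomb F B c ⊟ lincomb F B d
  lincomb-sub B c d j = trans (lincomb-+ B c (λ i → - d i) j) (+-congˡ (lincomb-neg B d j))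

  lincomb-⊟ : ∀ {m r} (P Q : Fin r → V m) c → lincomb F (λ i → P i ⊟ Q i) c ≋ lincomb F P c ⊟ lincomb F Q c
  lincomb-⊟ {r = r} P Q c j = begin
    sum (λ i → c i * (P i j - Q i j))                    ≈⟨ sum-cong-≋ {r} (λ i → x[y-z]≈xy-xz (c i) (P i j) (Q i j)) ⟩
    sum (λ i → c i * P i j + - (c i * Q i j))            ≈⟨ sum-cong-≋ {r} (λ i → +-congˡ (-‿distribˡ-* (c i) (Q i j))) ⟩
    sum (λ i → c i * P i j + - c i * Q i j)              ≈⟨ ∑-distrib-+ (λ i → c i * P i j) (λ i → - c i * Q i j) ⟩
    lincomb F P c j + lincomb F Q (λ i → - c i) j        ≈⟨ +-congˡ (lincomb-neg Q c j) ⟩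
    lincomb F P c j - lincomb F Q c j                    ∎

  lincomb-removeAt : ∀ {m r} (B : Fin (suc r) → V m) c s →
                     lincomb F B c ≋ c s ⊙ B s ⊞ lincomb F (removeAt B s) (removeAt c s)
  lincomb-removeAt B c s j = sum-remove {i = s} (λ i → c i * B i j)

  lincomb-lincomb : ∀ {m r u} (B : Fin r → V m) (coeffs : Fin u → Fin r → Carrier) c →
                    lincomb F (λ κ → lincomb F B (coeffs κ)) c ≋ lincomb F B (λ i → sum (λ κ → c κ * coeffs κ i))
  lincomb-lincomb {r = r} {u} B coeffs c j = begin
    sum (λ κ → c κ * sum (λ i → coeffs κ i * B i j))
      ≈⟨ sum-cong-≋ {u} (λ κ → *-distribˡ-sum (c κ) (λ i → coeffs κ i * B i j)) ⟩
    sum (λ κ → sum (λ i → c κ * (coeffs κ i * B i j)))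
      ≈⟨ ∑-comm (λ κ i → c κ * (coeffs κ i * B i j)) ⟩
    sum (λ i → sum (λ κ → c κ * (coeffs κ i * B i j)))
      ≈⟨ sum-cong-≋ {r} (λ i → sum-cong-≋ {u} (λ κ → sym (*-assoc (c κ) (coeffs κ i) (B i j)))) ⟩
    sum (λ i → sum (λ κ → c κ * coeffs κ i * B i j))
      ≈⟨ sum-cong-≋ {r} (λ i → sym (*-distribʳ-sum (B i j) (λ κ → c κ * coeffs κ i))) ⟩
    sum (λ i → sum (λ κ → c κ * coeffs κ i) * B i j) ∎

  lincomb-++ : ∀ {m k b} (C : Fin k → V m) (B : Fin b → V m) c d →
               lincomb F (C ++ B) (c ++ d) ≋ lincomb F C c ⊞ lincomb F B d
  lincomb-++ {k = zero} C B c d j = sym (+-identityˡ _)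
  lincomb-++ {k = suc k} {b} C B c d j = begin
    c zero * C zero j + sum (λ i → (c ++ d) (suc i) * (C ++ B) (suc i) j)
      ≈⟨ +-congˡ (sum-cong-≋ {k ℕ.+ b} (λ i → reflexive
           (≡.cong₂ (λ a v → a * v j) (++-∷ c d (suc i)) (++-∷ C B (suc i))))) ⟩
    c zero * C zero j + lincomb F (tail C ++ B) (tail c ++ d) j
      ≈⟨ +-congˡ (lincomb-++ (tail C) B (tail c) d j) ⟩
    c zero * C zero j + (lincomb F (tail C) (tail c) j + lincomb F B d j)
      ≈⟨ +-assoc _ _ _ ⟨
    c zero * C zero j + lincomb F (tail C) (tail c) j + lincomb F B d j ∎

  lincomb-split : ∀ {m k b} (C : Fin k → V m) (B : Fin b → V m) e →
                  lincomb F (C ++ B) e ≋ lincomb F C (take k e) ⊞ lincomb F B (drop k e)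
  lincomb-split {k = k} C B e j =
    trans (lincomb-congʳ (C ++ B) (λ i → reflexive (take++drop k e i)) j) (lincomb-++ C B (take k e) (drop k e) j)

  lincomb-standard : ∀ {m} (v : V m) → lincomb F δ v ≋ v
  lincomb-standard {suc m} v j = trans (sum-cong-≋ {suc m} (λ k → *-comm (v k) (δ k j))) (sum-δ v j)

  InSpan-resp-≋ : ∀ {m r} {B : Fin r → V m} {v w} → v ≋ w → InSpan F B v → InSpan F B w
  InSpan-resp-≋ v≋w (c , v≋Bc) = c , λ j → trans (sym (v≋w j)) (v≋Bc j)

  InSpan-member : ∀ {m r} (B : Fin r → V m) i → InSpan F B (B i)
  InSpan-member {r = suc r} B i = (λ k → δ k i) , λ j → sym (sum-δ (λ k → B k j) i)

  InSpan-standard : ∀ {m} (v : V m) → InSpan F δ v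
  InSpan-standard v = v , λ j → sym (lincomb-standard v j)

  InSpan-sub : ∀ {m r} {B : Fin r → V m} {u v} → InSpan F B u → InSpan F B v → InSpan F B (u ⊟ v)
  InSpan-sub {B = B} (c , u≋) (d , v≋) =
    (λ i → c i - d i) , λ j → trans (+-cong (u≋ j) (-‿cong (v≋ j))) (sym (lincomb-sub B c d j))

  InSpan-scale : ∀ {m r} {B : Fin r → V m} a {v} → InSpan F B v → InSpan F B (a ⊙ v)
  InSpan-scale {B = B} a (c , v≋) = (λ i → a * c i) , λ j → trans (*-congˡ (v≋ j)) (sym (lincomb-scale B a c j))

  InSpan-lincomb : ∀ {m r u} {B : Fin r → V m} {U : Fin u → V m} →
                   (∀ κ → InSpan F B (U κ)) → ∀ c → InSpan F B (lincomb F U c)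
  InSpan-lincomb {B = B} {U} U⊆B c =
    (λ i → sum (λ κ → c κ * coeffs κ i)) ,
    λ j → trans (lincomb-cong (λ κ → proj₂ (U⊆B κ)) (λ _ → refl) j) (lincomb-lincomb B coeffs c j)
    where
    coeffs = λ κ → proj₁ (U⊆B κ)

  InSpan-trans : ∀ {m r u} {B : Fin r → V m} {U : Fin u → V m} {v} →
                 (∀ κ → InSpan F B (U κ)) → InSpan F U v → InSpan F B v
  InSpan-trans U⊆B (c , v≋) = InSpan-resp-≋ (λ j → sym (v≋ j)) (InSpan-lincomb U⊆B c)

  ≋⇒InSpan : ∀ {m r} {B B′ : Fin r → V m} → (∀ i → B i ≋ B′ i) → ∀ i → InSpan F B′ (B i)
  ≋⇒InSpan {B′ = B′} B≋B′ i = InSpan-resp-≋ (λ j → sym (B≋B′ i j)) (InSpan-member B′ i)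

  InSpan-∷ : ∀ {m r} {B : Fin r → V m} w {v} → InSpan F B v → InSpan F (w ∷ B) v
  InSpan-∷ w (c , v≋) = (0# ∷ c) , λ j → trans (v≋ j) (trans (sym (+-identityˡ _)) (+-congʳ (sym (zeroˡ (w j)))))

  InSpan-++[] : ∀ {m k} {C : Fin k → V m} {v} → InSpan F (C ++ []) v → InSpan F C v
  InSpan-++[] {k = k} {C} (e , v≋) =
    take k e , λ j → trans (v≋ j) (trans (lincomb-split C [] e j) (+-identityʳ _))

  InSpan? : ∀ {m r} (B : Fin r → V m) v → Dec (InSpan F B v)
  InSpan? {r = r} B v with Finₚ.any? {n = size ℕ.^ r} (λ i → Finₚ.all? (λ j → v j ≈? lincomb F B (enum ∘ finToFun i) j))
  ... | yes (i , v≋) = yes (enum ∘ finToFun i , v≋)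
  ... | no ∉ = no λ (c , v≋) → ∉ (funToFin (index ∘ c) , λ j → trans (v≋ j) (lincomb-congʳ B (decode c) j))
    where
    decode : ∀ c x → c x ≈ enum (finToFun (funToFin (index ∘ c)) x)
    decode c x = trans (sym (enum-index (c x))) (reflexive (≡.cong enum (≡.sym (Finₚ.finToFun-funToFin (index ∘ c) x))))

  LinIndep-resp : ∀ {m r} {B B′ : Fin r → V m} → (∀ i → B i ≋ B′ i) → LinIndep F B → LinIndep F B′
  LinIndep-resp B≋B′ indep c B′c≈0 = indep c (λ j → trans (lincomb-cong B≋B′ (λ _ → refl) j) (B′c≈0 j))

  LinIndep-∷ : ∀ {m r} {B : Fin r → V m} {v} → LinIndep F B → ¬ InSpan F B v → LinIndep F (v ∷ B)
  LinIndep-∷ {B = B} {v} indep v∉B c vBc≈0 with c zero ≈? 0#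
  ... | yes c₀≈0 = λ { zero → c₀≈0 ; (suc i) → indep (tail c) Bc≈0 i }
    where
    Bc≈0 : IsZero F (lincomb F B (tail c))
    Bc≈0 j = begin
      lincomb F B (tail c) j                 ≈⟨ +-identityˡ _ ⟨
      0# + lincomb F B (tail c) j            ≈⟨ +-congʳ (trans (*-congʳ c₀≈0) (zeroˡ (v j))) ⟨
      c zero * v j + lincomb F B (tail c) j  ≈⟨ vBc≈0 j ⟩
      0#                                     ∎
  ... | no c₀≉0 = ⊥-elim (v∉B ((λ i → - (ι * c (suc i))) , v≋))
    where
    ι = inv (c zero) c₀≉0
    v≋ : ∀ j → v j ≈ lincomb F B (λ i → - (ι * c (suc i))) j
    v≋ j = begin
      v j                                   ≈⟨ *-identityˡ (v j) ⟨
      1# * v j                              ≈⟨ *-congʳ (*-inverseˡ _ c₀≉0) ⟨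
      ι * c zero * v j                      ≈⟨ *-assoc _ _ _ ⟩
      ι * (c zero * v j)                    ≈⟨ *-congˡ (inverseˡ-unique _ _ (vBc≈0 j)) ⟩
      ι * - lincomb F B (tail c) j          ≈⟨ -‿distribʳ-* ι _ ⟨
      - (ι * lincomb F B (tail c) j)        ≈⟨ -‿cong (lincomb-scale B ι (tail c) j) ⟨
      - lincomb F B (λ i → ι * c (suc i)) j ≈⟨ lincomb-neg B (λ i → ι * c (suc i)) j ⟨
      lincomb F B (λ i → - (ι * c (suc i))) j ∎

  LinIndep-replace : ∀ {m r} {B : Fin (suc r) → V m} → LinIndep F B → ∀ s {μ} → μ ≉ 0# →
                     LinIndep F ((μ ⊙ B s) ∷ removeAt B s)
  LinIndep-replace {B = B} indep s {μ} μ≉0 e new≈0 = λ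
    { zero    → x*y≈0⇒y≈0 μ≉0 (trans (*-comm μ (e zero))
                    (trans (reflexive (≡.sym (Vecₚ.insertAt-lookup (tail e) s _))) (c≈0 s)))
    ; (suc i) → trans (reflexive (≡.sym (Vecₚ.insertAt-punchIn (tail e) s _ i))) (c≈0 (punchIn s i)) }
    where
    c = insertAt (tail e) s (e zero * μ)
    c≈0 : ∀ i → c i ≈ 0#
    c≈0 = indep c λ j → begin
      lincomb F B c j
        ≈⟨ lincomb-removeAt B c s j ⟩
      c s * B s j + lincomb F (removeAt B s) (removeAt c s) j
        ≈⟨ +-cong (*-congʳ (reflexive (Vecₚ.insertAt-lookup (tail e) s _)))
                  (lincomb-congʳ (removeAt B s) (λ i → reflexive (Vecₚ.insertAt-punchIn (tail e) s _ i)) j) ⟩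
      e zero * μ * B s j + lincomb F (removeAt B s) (tail e) j
        ≈⟨ +-congʳ (*-assoc _ _ _) ⟩
      e zero * (μ * B s j) + lincomb F (removeAt B s) (tail e) j
        ≈⟨ new≈0 j ⟩
      0# ∎

  LinIndep-++⇒disjoint : ∀ {m k b} {C : Fin k → V m} {B : Fin b → V m} → LinIndep F (C ++ B) →
                         ∀ g → InSpan F B (lincomb F C g) → ∀ i → g i ≈ 0#
  LinIndep-++⇒disjoint {b = b} {C} {B} indep g (d , Cg≋Bd) i =
    trans (reflexive (≡.sym (Vecₚ.lookup-++ˡ g _ i))) (indep (g ++ (λ i → - d i)) CBgd≈0 (i ↑ˡ b))
    where
    CBgd≈0 : IsZero F (lincomb F (C ++ B) (g ++ (λ i → - d i)))
    CBgd≈0 j = begin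
      lincomb F (C ++ B) (g ++ (λ i → - d i)) j        ≈⟨ lincomb-++ C B g _ j ⟩
      lincomb F C g j + lincomb F B (λ i → - d i) j    ≈⟨ +-congˡ (lincomb-neg B d j) ⟩
      lincomb F C g j - lincomb F B d j                ≈⟨ +-congˡ (-‿cong (Cg≋Bd j)) ⟨
      lincomb F C g j - lincomb F C g j                ≈⟨ -‿inverseʳ _ ⟩
      0#                                               ∎

  LinIndep-++ˡ : ∀ {m k b} {C : Fin k → V m} {B : Fin b → V m} → LinIndep F (C ++ B) → LinIndep F C
  LinIndep-++ˡ {B = B} indep c Cc≈0 =
    LinIndep-++⇒disjoint indep c ((λ _ → 0#) , λ j → trans (Cc≈0 j) (sym (lincomb-zero B (λ _ → refl) j)))

  -- By counting: coordinates with respect to B embed F^u into F^b.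
  steinitz : ∀ {m u b} {U : Fin u → V m} {B : Fin b → V m} → LinIndep F U → (∀ κ → InSpan F B (U κ)) → u ℕ.≤ b
  steinitz {u = u} {b} {U} {B} indep U⊆B = ^-cancelʳ-≤ size 1<size (Finₚ.injective⇒≤ Φ-injective)
    where
    φ : (Fin u → Carrier) → Fin b → Carrier
    φ c i = sum (λ κ → c κ * proj₁ (U⊆B κ) i)

    φ-injective : ∀ c c′ → (∀ i → φ c i ≈ φ c′ i) → ∀ κ → c κ ≈ c′ κ
    φ-injective c c′ φc≈φc′ κ = x∙y⁻¹≈ε⇒x≈y _ _ (indep (λ κ → c κ - c′ κ) Uc-Uc′≈0 κ)
      where
      Uc≋Bφc : ∀ c → lincomb F U c ≋ lincomb F B (φ c)
      Uc≋Bφc c = InSpan-lincomb U⊆B c .proj₂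
      Uc-Uc′≈0 : IsZero F (lincomb F U (λ κ → c κ - c′ κ))
      Uc-Uc′≈0 j = begin
        lincomb F U (λ κ → c κ - c′ κ) j            ≈⟨ lincomb-sub U c c′ j ⟩
        lincomb F U c j - lincomb F U c′ j          ≈⟨ +-congˡ (-‿cong (Uc≋Bφc c′ j)) ⟩
        lincomb F U c j - lincomb F B (φ c′) j      ≈⟨ +-congʳ (trans (Uc≋Bφc c j) (lincomb-congʳ B φc≈φc′ j)) ⟩
        lincomb F B (φ c′) j - lincomb F B (φ c′) j ≈⟨ -‿inverseʳ _ ⟩
        0#                                          ∎

    Φ : Fin (size ℕ.^ u) → Fin (size ℕ.^ b)
    Φ i = funToFin (index ∘ φ (enum ∘ finToFun i))

    Φ-injective : ∀ {i i′} → Φ i ≡ Φ i′ → i ≡ i′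
    Φ-injective {i} {i′} eq = ≡.trans (≡.sym (Finₚ.funToFin-finToFin {u} {size} i))
      (≡.trans (funToFin-cong (λ κ → enum-injective _ _ (φ-injective _ _ (λ x → index-injective (funToFin-injective eq x)) κ)))
               (Finₚ.funToFin-finToFin {u} {size} i′))

  record Extension {m b x} (B : Fin b → V m) (X : Fin x → V m) : Set where
    field
      {k}         : ℕ
      pick        : Fin k → Fin x
      independent : LinIndep F ((X ∘ pick) ++ B)
      spanning    : ∀ i → InSpan F ((X ∘ pick) ++ B) (X i)

  extend : ∀ {m b x} {B : Fin b → V m} → LinIndep F B → (X : Fin x → V m) → Extension B X
  extend {x = zero} indep X = record { pick = λ () ; independent = indep ; spanning = λ () }
  extend {x = suc x} {B} indep X with extend indep (X ∘ suc)
  ... | e with InSpan? ((X ∘ suc ∘ Extension.pick e) ++ B) (X zero)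
  ...   | yes X₀∈ = record
    { pick = suc ∘ pick ; independent = independent ; spanning = λ { zero → X₀∈ ; (suc i) → spanning i } }
    where open Extension e
  ...   | no X₀∉ = record
    { pick = zero ∷ suc ∘ pick
    ; independent = LinIndep-resp {B = cons} {B′ = new} reorder (LinIndep-∷ independent X₀∉)
    ; spanning = λ i → InSpan-trans {B = new} {U = cons} (≋⇒InSpan reorder) (spanning′ i) }
    where
    open Extension e
    cons = X zero ∷ ((X ∘ suc ∘ pick) ++ B)
    new = (X ∘ (zero ∷ suc ∘ pick)) ++ B
    reorder : ∀ i → cons i ≋ new i
    reorder i j = reflexive (≡.cong (λ v → v j) (≡.sym (++-∷ (X ∘ (zero ∷ suc ∘ pick)) B i)))
    spanning′ : ∀ i → InSpan F cons (X i)
    spanning′ zero = InSpan-member cons zero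
    spanning′ (suc i) = InSpan-∷ (X zero) (spanning i)

  independent-subfamily : ∀ {m x} (X : Fin x → V m) →
    ∃ λ t → Σ (Fin t → Fin x) λ σ → LinIndep F (X ∘ σ) × (∀ i → InSpan F (X ∘ σ) (X i))
  independent-subfamily X = _ , pick , LinIndep-++ˡ independent , InSpan-++[] ∘ spanning
    where open Extension (extend {B = []} (λ _ _ ()) X)

  steinitz-spanning : ∀ {m u b} {U : Fin u → V m} {B : Fin b → V m} → LinIndep F U →
                      (∀ κ → InSpan F B (U κ)) → b ℕ.≤ u → ∀ i → InSpan F U (B i)
  steinitz-spanning {U = U} {B} indep U⊆B b≤u i with InSpan? U (B i)
  ... | yes Bi∈U = Bi∈U
  ... | no  Bi∉U = ⊥-elim (ℕₚ.<⇒≱ (steinitz (LinIndep-∷ indep Bi∉U) BiU⊆B) b≤u)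
    where
    BiU⊆B : ∀ κ → InSpan F B ((B i ∷ U) κ)
    BiU⊆B zero = InSpan-member B i
    BiU⊆B (suc κ) = U⊆B κ

  -- Coordinates with a 1 in position ℓ: a point of PG(r, q) costs r field elements.
  normalised : ∀ {r} → Fin (suc r) × (Fin r → Fin size) → Fin (suc r) → Carrier
  normalised (ℓ , e) = insertAt (enum ∘ e) ℓ 1#

  insertAt-≈ : ∀ {r} (xs : Fin r → Carrier) ℓ {v} (a : Fin (suc r) → Carrier) →
               (∀ j → xs j ≈ removeAt a ℓ j) → v ≈ a ℓ → ∀ i → insertAt xs ℓ v i ≈ a i
  insertAt-≈ xs zero a xs≈ v≈ zero = v≈
  insertAt-≈ xs zero a xs≈ v≈ (suc i) = xs≈ i
  insertAt-≈ {suc r} xs (suc ℓ) a xs≈ v≈ zero = xs≈ zero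
  insertAt-≈ {suc r} xs (suc ℓ) a xs≈ v≈ (suc i) = insertAt-≈ (tail xs) ℓ (tail a) (xs≈ ∘ suc) v≈ i

  record Normalisation {r} (a : Fin (suc r) → Carrier) : Set where
    field
      coords  : Fin (suc r) × (Fin r → Fin size)
      scale   : Carrier
      scale≉0 : scale ≉ 0#
      coords≈ : ∀ i → normalised coords i ≈ scale * a i

  normalise : ∀ {r} (a : Fin (suc r) → Carrier) → ¬ (∀ i → a i ≈ 0#) → Normalisation a
  normalise a a≉0 = record
    { coords = ℓ , index ∘ removeAt νa ℓ ; scale = ν ; scale≉0 = inv≉0 _ aℓ≉0
    ; coords≈ = insertAt-≈ _ ℓ νa (enum-index ∘ removeAt νa ℓ) (sym (*-inverseˡ _ aℓ≉0)) }
    where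
    ℓ = proj₁ (nonzero-entry a a≉0)
    aℓ≉0 = proj₂ (nonzero-entry a a≉0)
    ν = inv (a ℓ) aℓ≉0
    νa = λ i → ν * a i

  -- Reduced echelon form: pivot columns Z complete B to a basis of F^m, and the vectors
  -- e_col − Σᵢ aᵢ e_{Z i} lying in span B span it, each costing only z scalars.
  reduced : ∀ {m z} → (Fin z → Fin m) → Fin m → (Fin z → Carrier) → V m
  reduced Z col a = δ col ⊟ lincomb F (δ ∘ Z) a

  record Reduction {m r} (B : Fin r → V m) : Set where
    field
      z            : ℕ
      pivots       : Fin z → Fin m
      coeffs       : Fin m → Fin z → Carrier
      z+r≤m        : z ℕ.+ r ℕ.≤ m
      reduced∈span : ∀ col → InSpan F B (reduced pivots col (coeffs col))
      span⊆reduced : ∀ {v} → InSpan F B v → InSpan F (λ col → reduced pivots col (coeffs col)) v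

  reduction : ∀ {m r} {B : Fin r → V m} → LinIndep F B → Reduction B
  reduction {m} {r} {B} indep = record
    { z = k ; pivots = pick ; coeffs = coeffs ; z+r≤m = steinitz independent (λ _ → InSpan-standard _)
    ; reduced∈span = reduced∈span ; span⊆reduced = span⊆reduced }
    where
    open Extension (extend indep δ)
    Z = δ ∘ pick
    e : Fin m → Fin (k ℕ.+ r) → Carrier
    e col = proj₁ (spanning col)
    coeffs : Fin m → Fin k → Carrier
    coeffs col = take k (e col)
    X : Fin m → V m
    X col = reduced pick col (coeffs col)

    reduced∈span : ∀ col → InSpan F B (X col)
    reduced∈span col = drop k (e col) , λ j → begin
      δ col j - lincomb F Z (coeffs col) j                      ≈⟨ +-congʳ (trans (proj₂ (spanning col) j) (lincomb-split Z B (e col) j)) ⟩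
      lincomb F Z (coeffs col) j + lincomb F B (drop k (e col)) j - lincomb F Z (coeffs col) j
                                                                ≈⟨ xyx⁻¹≈y _ _ ⟩
      lincomb F B (drop k (e col)) j                            ∎

    span⊆reduced : ∀ {v} → InSpan F B v → InSpan F X v
    span⊆reduced {v} v∈B = v , λ j → sym (begin
      lincomb F X v j   ≈⟨ Xv≋v-u j ⟩
      v j - u j         ≈⟨ +-congˡ (-‿cong (u≈0 j)) ⟩
      v j - 0#          ≈⟨ +-congˡ -0#≈0# ⟩
      v j + 0#          ≈⟨ +-identityʳ _ ⟩
      v j               ∎)
      where
      g : Fin k → Carrier
      g i = sum (λ col → v col * coeffs col i)
      u = lincomb F Z g
      Xv≋v-u : lincomb F X v ≋ v ⊟ u
      Xv≋v-u j = trans (lincomb-⊟ δ (λ col → lincomb F Z (coeffs col)) v j)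
                       (+-cong (lincomb-standard v j) (-‿cong (lincomb-lincomb Z coeffs v j)))
      u∈B : InSpan F B u
      u∈B = InSpan-resp-≋ (λ j → trans (+-congˡ (-‿cong (Xv≋v-u j))) (x-[x-y]≈y (v j) (u j)))
                          (InSpan-sub v∈B (InSpan-lincomb reduced∈span v))
      u≈0 : IsZero F u
      u≈0 = lincomb-zero Z (LinIndep-++⇒disjoint independent g u∈B)

module Codes where
  open import Data.Nat using (_+_; _*_; _^_; _≤_; _<_; _⊔_; NonZero)
  open ℕₚ.≤-Reasoning
  open +-*-Solver using (solve; _:*_; _:=_)

  infixr 5 _⊕_
  infixr 6 _⊗_

  -- Sets of codes built from discrete choices and field elements (𝔽, one of q).
  data Shape : Set where
    fin     : ℕ → Shape
    𝔽       : Shape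
    _⊕_ _⊗_ : Shape → Shape → Shape
    Σ<      : ℕ → (ℕ → Shape) → Shape
    Π       : ℕ → Shape → Shape

  ⟦_⟧ : Shape → ℕ → Set
  ⟦ fin k ⟧  q = Fin k
  ⟦ 𝔽 ⟧      q = Fin q
  ⟦ a ⊕ b ⟧  q = ⟦ a ⟧ q ⊎ ⟦ b ⟧ q
  ⟦ a ⊗ b ⟧  q = ⟦ a ⟧ q × ⟦ b ⟧ q
  ⟦ Σ< k f ⟧ q = Σ ℕ λ i → i < k × ⟦ f i ⟧ q
  ⟦ Π k s ⟧  q = Fin k → ⟦ s ⟧ q

  ∑< max< : ℕ → (ℕ → ℕ) → ℕ
  ∑< zero    g = 0
  ∑< (suc k) g = g 0 + ∑< k (g ∘ suc)
  max< zero    g = 0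
  max< (suc k) g = g 0 ⊔ max< k (g ∘ suc)

  card : ℕ → Shape → ℕ
  card q (fin k)  = k
  card q 𝔽        = q
  card q (a ⊕ b)  = card q a + card q b
  card q (a ⊗ b)  = card q a * card q b
  card q (Σ< k f) = ∑< k (λ i → card q (f i))
  card q (Π k s)  = card q s ^ k

  degree : Shape → ℕ
  degree (fin k)  = 0
  degree 𝔽        = 1
  degree (a ⊕ b)  = degree a ⊔ degree b
  degree (a ⊗ b)  = degree a + degree b
  degree (Σ< k f) = max< k (λ i → degree (f i))
  degree (Π k s)  = k * degree s

  Eq⟦_⟧ : ∀ {q} s → ⟦ s ⟧ q → ⟦ s ⟧ q → Set
  Eq⟦ fin k ⟧  x y = x ≡ y
  Eq⟦ 𝔽 ⟧      x y = x ≡ y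
  Eq⟦ a ⊕ b ⟧  (inj₁ x) (inj₁ y) = Eq⟦ a ⟧ x y
  Eq⟦ a ⊕ b ⟧  (inj₂ x) (inj₂ y) = Eq⟦ b ⟧ x y
  Eq⟦ a ⊕ b ⟧  _        _        = ⊥
  Eq⟦ a ⊗ b ⟧  (x , x′) (y , y′) = Eq⟦ a ⟧ x y × Eq⟦ b ⟧ x′ y′
  Eq⟦_⟧ {q} (Σ< k f) (i , _ , x) (j , _ , y) = Σ (i ≡ j) λ i≡j → Eq⟦ f j ⟧ (≡.subst (λ i → ⟦ f i ⟧ q) i≡j x) y
  Eq⟦ Π k s ⟧  x y = ∀ i → Eq⟦ s ⟧ (x i) (y i)

  injectΣ : ∀ k {A : ℕ → Set} {size : ℕ → ℕ} → (∀ i → A i → Fin (size i)) → ∀ i → i < k → A i → Fin (∑< k size)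
  injectΣ (suc k) {size = size} enc zero    _         x = enc 0 x ↑ˡ ∑< k (size ∘ suc)
  injectΣ (suc k) {size = size} enc (suc i) (s≤s i<k) x = size 0 ↑ʳ injectΣ k (enc ∘ suc) i i<k x

  injectΣ-injective : ∀ k {A : ℕ → Set} {size : ℕ → ℕ} (enc : ∀ i → A i → Fin (size i)) (R : ∀ i → A i → A i → Set) →
                      (∀ i {x y} → enc i x ≡ enc i y → R i x y) →
                      ∀ {i j i<k j<k x y} → injectΣ k enc i i<k x ≡ injectΣ k enc j j<k y →
                      Σ (i ≡ j) λ i≡j → R j (≡.subst A i≡j x) y
  injectΣ-injective (suc k) enc R inj {zero} {zero} eq = ≡.refl , inj 0 (Finₚ.↑ˡ-injective _ _ _ eq)
  injectΣ-injective (suc k) enc R inj {zero} {suc j} {j<k = s≤s _} eq = ⊥-elim (↑ˡ≢↑ʳ _ _ eq)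
  injectΣ-injective (suc k) enc R inj {suc i} {zero} {s≤s _} eq = ⊥-elim (↑ˡ≢↑ʳ _ _ (≡.sym eq))
  injectΣ-injective (suc k) enc R inj {suc i} {suc j} {s≤s _} {s≤s _} eq
    with injectΣ-injective k (enc ∘ suc) (R ∘ suc) (inj ∘ suc) (Finₚ.↑ʳ-injective _ _ _ eq)
  ... | ≡.refl , r = ≡.refl , r

  encode : ∀ {q} s → ⟦ s ⟧ q → Fin (card q s)
  encode (fin k)        x        = x
  encode 𝔽              x        = x
  encode {q} (a ⊕ b)    (inj₁ x) = encode a x ↑ˡ card q b
  encode {q} (a ⊕ b)    (inj₂ y) = card q a ↑ʳ encode b y
  encode (a ⊗ b)        (x , y)  = Fin.combine (encode a x) (encode b y)
  encode {q} (Σ< k f)   (i , i<k , x) = injectΣ k (λ i → encode (f i)) i i<k x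
  encode (Π k s)        x        = funToFin (encode s ∘ x)

  encode-injective : ∀ {q} s {x y : ⟦ s ⟧ q} → encode s x ≡ encode s y → Eq⟦ s ⟧ x y
  encode-injective (fin k) eq = eq
  encode-injective 𝔽       eq = eq
  encode-injective (a ⊕ b) {inj₁ x} {inj₁ y} eq = encode-injective a (Finₚ.↑ˡ-injective _ _ _ eq)
  encode-injective (a ⊕ b) {inj₁ x} {inj₂ y} eq = ↑ˡ≢↑ʳ _ _ eq
  encode-injective (a ⊕ b) {inj₂ x} {inj₁ y} eq = ↑ˡ≢↑ʳ _ _ (≡.sym eq)
  encode-injective (a ⊕ b) {inj₂ x} {inj₂ y} eq = encode-injective b (Finₚ.↑ʳ-injective _ _ _ eq)
  encode-injective (a ⊗ b) {x , x′} {y , y′} eq with Finₚ.combine-injective _ _ _ _ eq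
  ... | eq₁ , eq₂ = encode-injective a eq₁ , encode-injective b eq₂
  encode-injective (Σ< k f) eq = injectΣ-injective k (λ i → encode (f i)) (λ i → Eq⟦ f i ⟧) (λ i → encode-injective (f i)) eq
  encode-injective (Π k s) eq i = encode-injective s (funToFin-injective eq i)

  ∑<-mono-≤ : ∀ k {g h : ℕ → ℕ} → (∀ i → i < k → g i ≤ h i) → ∑< k g ≤ ∑< k h
  ∑<-mono-≤ zero    g≤h = z≤n
  ∑<-mono-≤ (suc k) g≤h = ℕₚ.+-mono-≤ (g≤h 0 (s≤s z≤n)) (∑<-mono-≤ k (λ i i<k → g≤h (suc i) (s≤s i<k)))

  ∑<-*ʳ : ∀ k g c → ∑< k (λ i → g i * c) ≡ ∑< k g * c
  ∑<-*ʳ zero    g c = ≡.refl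
  ∑<-*ʳ (suc k) g c = ≡.trans (≡.cong (g 0 * c +_) (∑<-*ʳ k (g ∘ suc) c)) (≡.sym (ℕₚ.*-distribʳ-+ c (g 0) _))

  max<-upper : ∀ k g {i} → i < k → g i ≤ max< k g
  max<-upper (suc k) g {zero}  _         = ℕₚ.m≤m⊔n _ _
  max<-upper (suc k) g {suc i} (s≤s i<k) = ℕₚ.≤-trans (max<-upper k (g ∘ suc) i<k) (ℕₚ.m≤n⊔m _ _)

  max<-least : ∀ k g {E} → (∀ i → i < k → g i ≤ E) → max< k g ≤ E
  max<-least zero    g g≤E = z≤n
  max<-least (suc k) g g≤E = ℕₚ.⊔-lub (g≤E 0 (s≤s z≤n)) (max<-least k (g ∘ suc) (λ i i<k → g≤E (suc i) (s≤s i<k)))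

  ^-distribʳ-* : ∀ a b k → (a * b) ^ k ≡ a ^ k * b ^ k
  ^-distribʳ-* a b zero    = ≡.refl
  ^-distribʳ-* a b (suc k) = ≡.trans (≡.cong (a * b *_) (^-distribʳ-* a b k))
    (solve 4 (λ a b x y → a :* b :* (x :* y) := a :* x :* (b :* y)) ≡.refl a b (a ^ k) (b ^ k))

  mutual
    card≤card₁*q^degree : ∀ q .{{_ : NonZero q}} s → card q s ≤ card 1 s * q ^ degree s
    card≤card₁*q^degree q (fin k) = ℕₚ.≤-reflexive (≡.sym (ℕₚ.*-identityʳ k))
    card≤card₁*q^degree q 𝔽       = ℕₚ.≤-reflexive (≡.sym (≡.trans (ℕₚ.+-identityʳ (q * 1)) (ℕₚ.*-identityʳ q)))
    card≤card₁*q^degree q (a ⊕ b) = begin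
      card q a + card q b
        ≤⟨ ℕₚ.+-mono-≤ (card≤card₁*q^ q a (ℕₚ.m≤m⊔n (degree a) (degree b)))
                       (card≤card₁*q^ q b (ℕₚ.m≤n⊔m (degree a) (degree b))) ⟩
      card 1 a * q ^ degree (a ⊕ b) + card 1 b * q ^ degree (a ⊕ b)
        ≡⟨ ℕₚ.*-distribʳ-+ _ (card 1 a) _ ⟨
      card 1 (a ⊕ b) * q ^ degree (a ⊕ b) ∎
    card≤card₁*q^degree q (a ⊗ b) = begin
      card q a * card q b                                 ≤⟨ ℕₚ.*-mono-≤ (card≤card₁*q^degree q a) (card≤card₁*q^degree q b) ⟩
      card 1 a * q ^ degree a * (card 1 b * q ^ degree b)  ≡⟨ solve 4 (λ a b x y → a :* x :* (b :* y) := a :* b :* (x :* y)) ≡.refl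
                                                                (card 1 a) (card 1 b) (q ^ degree a) (q ^ degree b) ⟩
      card 1 a * card 1 b * (q ^ degree a * q ^ degree b)  ≡⟨ ≡.cong (card 1 a * card 1 b *_) (ℕₚ.^-distribˡ-+-* q (degree a) (degree b)) ⟨
      card 1 (a ⊗ b) * q ^ degree (a ⊗ b)                 ∎
    card≤card₁*q^degree q (Σ< k f) = begin
      ∑< k (λ i → card q (f i))                           ≤⟨ ∑<-mono-≤ k (λ i i<k →
                                                               card≤card₁*q^ q (f i) (max<-upper k (λ i → degree (f i)) i<k)) ⟩
      ∑< k (λ i → card 1 (f i) * q ^ degree (Σ< k f))     ≡⟨ ∑<-*ʳ k (λ i → card 1 (f i)) _ ⟩
      card 1 (Σ< k f) * q ^ degree (Σ< k f)               ∎
    card≤card₁*q^degree q (Π k s) = begin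
      card q s ^ k                                        ≤⟨ ℕₚ.^-monoˡ-≤ k (card≤card₁*q^degree q s) ⟩
      (card 1 s * q ^ degree s) ^ k                       ≡⟨ ^-distribʳ-* (card 1 s) (q ^ degree s) k ⟩
      card 1 s ^ k * (q ^ degree s) ^ k                   ≡⟨ ≡.cong (card 1 s ^ k *_) (≡.trans (ℕₚ.^-*-assoc q (degree s) k)
                                                                                             (≡.cong (q ^_) (ℕₚ.*-comm (degree s) k))) ⟩
      card 1 (Π k s) * q ^ degree (Π k s)                 ∎

    card≤card₁*q^ : ∀ q .{{_ : NonZero q}} s {E} → degree s ≤ E → card q s ≤ card 1 s * q ^ E
    card≤card₁*q^ q s d≤E = ℕₚ.≤-trans (card≤card₁*q^degree q s) (ℕₚ.*-monoʳ-≤ (card 1 s) (ℕₚ.^-monoʳ-≤ q d≤E))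

open Codes

module CodeShapes (n₁ : ℕ) where
  open import Data.Nat using (_+_; _*_; _∸_; _≤_; _<_)
  open ℕₚ.≤-Reasoning
  open +-*-Solver using (solve; _:+_; _:*_; _:=_; con)

  n N m : ℕ
  n = suc n₁
  N = n + 1
  m = suc (2 * n)

  Normalised : ℕ → Shape
  Normalised r = fin (suc r) ⊗ Π r 𝔽

  Point : Shape
  Point = fin N ⊗ Normalised n₁

  Reduced : ℕ → Shape
  Reduced z = fin m ⊗ Π z 𝔽

  Completion : ℕ → Shape
  Completion t = Σ< (suc n) λ z → Π z (fin m) ⊗ Σ< (suc (n₁ ∸ t)) λ k → Π k (Reduced z)

  Dependent : ℕ → Shape
  Dependent t = fin N ⊗ fin N ⊗ Π (suc t) Point ⊗ Normalised t ⊗ Completion t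

  Code : Shape
  Code = Π N (Normalised n₁) ⊕ Σ< n Dependent

  degree-Completion : ∀ t → degree (Completion t) ≤ (n₁ ∸ t) * n
  degree-Completion t = max<-least (suc n) _ λ z z<1+n → begin
    z * 0 + max< (suc (n₁ ∸ t)) (λ k → k * (z * 1))  ≡⟨ ≡.cong (_+ max< (suc (n₁ ∸ t)) (λ k → k * (z * 1))) (ℕₚ.*-zeroʳ z) ⟩
    max< (suc (n₁ ∸ t)) (λ k → k * (z * 1))          ≤⟨ max<-least (suc (n₁ ∸ t)) _ (λ k k<1+r →
                                                          ℕₚ.*-mono-≤ (ℕₚ.≤-pred k<1+r)
                                                            (ℕₚ.≤-trans (ℕₚ.≤-reflexive (ℕₚ.*-identityʳ z)) (ℕₚ.≤-pred z<1+n))) ⟩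
    (n₁ ∸ t) * n                                     ∎

  degree-Dependent : ∀ t → t < n → degree (Dependent t) ≤ n₁ + n₁ * n
  degree-Dependent t (s≤s t≤n₁) with ℕₚ.m≤n⇒∃[o]m+o≡n t≤n₁
  ... | r , ≡.refl = begin
    suc t * ((t + r) * 1) + (t * 1 + degree (Completion t))
      ≤⟨ ℕₚ.+-monoʳ-≤ (suc t * ((t + r) * 1)) (ℕₚ.+-monoʳ-≤ (t * 1) (degree-Completion t)) ⟩
    suc t * ((t + r) * 1) + (t * 1 + (t + r ∸ t) * n)
      ≡⟨ ≡.cong (λ d → suc t * ((t + r) * 1) + (t * 1 + d * n)) (ℕₚ.m+n∸m≡n t r) ⟩
    suc t * ((t + r) * 1) + (t * 1 + r * suc (t + r))
      ≡⟨ solve 2 (λ t r → (con 1 :+ t) :* ((t :+ r) :* con 1) :+ (t :* con 1 :+ r :* (con 1 :+ (t :+ r)))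
                          := (t :+ r) :+ (t :+ r) :* (con 1 :+ (t :+ r))) ≡.refl t r ⟩
    (t + r) + (t + r) * suc (t + r) ∎

  degree-Code : degree Code ≤ n₁ + n₁ * n
  degree-Code = ℕₚ.⊔-lub
    (ℕₚ.≤-reflexive (solve 1 (λ x → (con 1 :+ x :+ con 1) :* (x :* con 1) := x :+ x :* (con 1 :+ x)) ≡.refl n₁))
    (max<-least n _ degree-Dependent)

module Geometry (F : FiniteField) (n₁ : ℕ)
                (A : Fin (suc n₁ ℕ.+ 1) → ProjSubspace F (2 ℕ.* suc n₁) n₁)
                (skew : ∀ i j → i ≢ j → Skew F (A i) (A j)) where
  open FiniteField F hiding (zero)
  open LinearAlgebra F
  open CodeShapes n₁
  open import Algebra.Properties.AbelianGroup +-abelianGroup using (x∙y⁻¹≈ε⇒x≈y)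
  open import Relation.Binary.Reasoning.Setoid setoid

  q : ℕ
  q = size

  Space : Set
  Space = ProjSubspace F (2 ℕ.* n) n

  pointOn : Fin N → ⟦ Normalised n₁ ⟧ q → V m
  pointOn i x = lincomb F (basis (A i)) (normalised x)

  point : ⟦ Point ⟧ q → V m
  point (i , x) = pointOn i x

  reducedVector : ∀ {z} → (Fin z → Fin m) → ⟦ Reduced z ⟧ q → V m
  reducedVector Z (col , a) = reduced Z col (enum ∘ a)

  record Spans {r} (G : Fin r → V m) (S : Space) : Set where
    constructor spans
    field
      ⊆space : ∀ i → InSpan F (basis S) (G i)
      covers : ∀ i → InSpan F G (basis S i)

  CompletedBy : ∀ {r} t → (Fin r → V m) → ⟦ Completion t ⟧ q → Space → Set
  CompletedBy t P (z , _ , Z , k , _ , W) = Spans ((reducedVector Z ∘ W) ++ P)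

  -- In a dependent code the vector y ∈ A a is not stored: y + Σᵢ dᵢ Pᵢ ∈ A j determines
  -- it, because A a and A j are skew.
  Represents : Space → ⟦ Code ⟧ q → Set
  Represents S (inj₁ x) = Spans (λ i → pointOn i (x i)) S
  Represents S (inj₂ (t , _ , a , j , P , d , w)) =
    a ≢ j × Σ (V m) λ y → InSpan F (basis (A a)) y ×
                          InSpan F (basis (A j)) (y ⊞ lincomb F (point ∘ P) (normalised d)) ×
                          CompletedBy t (y ∷ point ∘ P) w S

  Spans⇒SameSpace : ∀ {r} {G G′ : Fin r → V m} {S S′ : Space} →
                    Spans G S → Spans G′ S′ → (∀ i → G i ≋ G′ i) → SameSpace F S S′
  Spans⇒SameSpace {G = G} {G′} {S} {S′} (spans G⊆S S⊆G) (spans G′⊆S′ S′⊆G′) G≋G′ v = S⊆S′ , S′⊆S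
    where
    S⊆S′ : InSpan F (basis S) v → InSpan F (basis S′) v
    S⊆S′ v∈S = InSpan-trans {B = basis S′} {U = G′} G′⊆S′
                 (InSpan-trans {B = G′} {U = G} (≋⇒InSpan G≋G′) (InSpan-trans {B = G} {U = basis S} S⊆G v∈S))
    S′⊆S : InSpan F (basis S′) v → InSpan F (basis S) v
    S′⊆S v∈S′ = InSpan-trans {B = basis S} {U = G} G⊆S
                  (InSpan-trans {B = G} {U = G′} (≋⇒InSpan (λ i j → sym (G≋G′ i j))) (InSpan-trans {B = G′} {U = basis S′} S′⊆G′ v∈S′))

  normalised-cong : ∀ {r} {x y : ⟦ Normalised r ⟧ q} → Eq⟦ Normalised r ⟧ x y → normalised x ≋ normalised y
  normalised-cong {x = ℓ , e} {.ℓ , e′} (≡.refl , e≡e′) = insertAt-≈ (enum ∘ e) ℓ (normalised (ℓ , e′))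
    (λ j → reflexive (≡.trans (≡.cong enum (e≡e′ j)) (≡.sym (Vecₚ.removeAt-insertAt (enum ∘ e′) ℓ 1# j))))
    (reflexive (≡.sym (Vecₚ.insertAt-lookup (enum ∘ e′) ℓ 1#)))

  pointOn-cong : ∀ i {x y} → Eq⟦ Normalised n₁ ⟧ x y → pointOn i x ≋ pointOn i y
  pointOn-cong i x≈y = lincomb-congʳ (basis (A i)) (normalised-cong x≈y)

  point-cong : ∀ {x y} → Eq⟦ Point ⟧ x y → point x ≋ point y
  point-cong {i , _} (≡.refl , x≈y) = pointOn-cong i x≈y

  reducedVector-cong : ∀ {z} {Z Z′ : Fin z → Fin m} → Z ≗ Z′ → ∀ {x y} → Eq⟦ Reduced z ⟧ x y →
                       reducedVector Z x ≋ reducedVector Z′ y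
  reducedVector-cong Z≗Z′ (≡.refl , a≡a′) j = +-congˡ (-‿cong (lincomb-cong
    (λ i k → reflexive (≡.cong (λ c → δ c k) (Z≗Z′ i))) (λ i → reflexive (≡.cong enum (a≡a′ i))) j))

  skew-cancel : ∀ {a j} → a ≢ j → ∀ {y y′ u u′ : V m} → u ≋ u′ →
                InSpan F (basis (A a)) y → InSpan F (basis (A a)) y′ →
                InSpan F (basis (A j)) (y ⊞ u) → InSpan F (basis (A j)) (y′ ⊞ u′) → y ≋ y′
  skew-cancel {a} {j} a≢j {y} {y′} {u} {u′} u≋u′ y∈Aa y′∈Aa y+u∈Aj y′+u′∈Aj with IsZero? (y ⊟ y′)
  ... | yes y-y′≈0 = λ i → x∙y⁻¹≈ε⇒x≈y _ _ (y-y′≈0 i)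
  ... | no  y-y′≉0 = ⊥-elim (skew a j a≢j (y ⊟ y′ , y-y′≉0 , InSpan-sub {B = basis (A a)} y∈Aa y′∈Aa ,
                      InSpan-resp-≋ {B = basis (A j)} difference (InSpan-sub {B = basis (A j)} y+u∈Aj y′+u′∈Aj)))
    where
    difference : (y ⊞ u) ⊟ (y′ ⊞ u′) ≋ y ⊟ y′
    difference i = trans (+-congˡ (-‿cong (+-congˡ (sym (u≋u′ i))))) ([x+z]-[y+z]≈x-y (y i) (y′ i) (u i))

  CompletedBy-unique : ∀ {r t} {P P′ : Fin r → V m} {S S′ : Space} (w w′ : ⟦ Completion t ⟧ q) → (∀ i → P i ≋ P′ i) →
                       CompletedBy t P w S → CompletedBy t P′ w′ S′ → Eq⟦ Completion t ⟧ w w′ → SameSpace F S S′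
  CompletedBy-unique (z , _ , Z , k , _ , W) (.z , _ , Z′ , .k , _ , W′) P≋P′ R R′ (≡.refl , Z≡Z′ , ≡.refl , W≈W′) =
    Spans⇒SameSpace R R′ (++-pointwise _≋_ (λ κ → reducedVector-cong Z≡Z′ (W≈W′ κ)) P≋P′)

  Represents-unique : ∀ {S S′ : Space} c c′ → Represents S c → Represents S′ c′ → Eq⟦ Code ⟧ c c′ → SameSpace F S S′
  Represents-unique (inj₁ x) (inj₁ x′) R R′ x≈x′ = Spans⇒SameSpace R R′ (λ i → pointOn-cong i (x≈x′ i))
  Represents-unique (inj₂ (t , _ , a , j , P , d , w)) (inj₂ (.t , _ , .a , .j , P′ , d′ , w′))
                    (a≢j , y , y∈Aa , y+u∈Aj , R) (_ , y′ , y′∈Aa , y′+u′∈Aj , R′)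
                    (≡.refl , ≡.refl , ≡.refl , P≈P′ , d≈d′ , w≈w′) =
    CompletedBy-unique {t = t} w w′ yP≋y′P′ R R′ w≈w′
    where
    P≋P′ : ∀ i → point (P i) ≋ point (P′ i)
    P≋P′ i = point-cong (P≈P′ i)
    y≋y′ : y ≋ y′
    y≋y′ = skew-cancel a≢j (lincomb-cong P≋P′ (normalised-cong d≈d′)) y∈Aa y′∈Aa y+u∈Aj y′+u′∈Aj
    yP≋y′P′ : ∀ i → (y ∷ point ∘ P) i ≋ (y′ ∷ point ∘ P′) i
    yP≋y′P′ zero    = y≋y′
    yP≋y′P′ (suc i) = P≋P′ i

  pointOn∈A : ∀ i x → InSpan F (basis (A i)) (pointOn i x)
  pointOn∈A i x = normalised x , λ j → refl

  pointOn≉0 : ∀ i x → ¬ IsZero F (pointOn i x)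
  pointOn≉0 i x@(ℓ , e) x≈0 =
    0≉1 (trans (sym (indep (A i) (normalised x) x≈0 ℓ)) (reflexive (Vecₚ.insertAt-lookup (enum ∘ e) ℓ 1#)))

  meet-point : ∀ {S : Space} i → Meets F S (A i) → Σ (⟦ Normalised n₁ ⟧ q) λ x → InSpan F (basis S) (pointOn i x)
  meet-point {S} i (v , v≉0 , v∈S , a , v≋Aa) =
    coords , InSpan-resp-≋ {B = basis S} νv≋ (InSpan-scale {B = basis S} scale v∈S)
    where
    open Normalisation (normalise a λ a≈0 → v≉0 (λ j → trans (v≋Aa j) (lincomb-zero (basis (A i)) a≈0 j)))
    νv≋ : scale ⊙ v ≋ pointOn i coords
    νv≋ j = sym (begin
      lincomb F (basis (A i)) (normalised coords) j       ≈⟨ lincomb-congʳ (basis (A i)) coords≈ j ⟩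
      lincomb F (basis (A i)) (λ k → scale * a k) j       ≈⟨ lincomb-scale (basis (A i)) scale a j ⟩
      scale * lincomb F (basis (A i)) a j                 ≈⟨ *-congˡ (v≋Aa j) ⟨
      scale * v j                                         ∎)

  module Encoding (S : Space) (meets : ∀ i → Meets F S (A i)) where
    open Reduction (reduction {B = basis S} (indep S))

    X : Fin m → V m
    X col = reduced pivots col (coeffs col)

    z≤dim : z ℕ.≤ n
    z≤dim = ℕₚ.+-cancelʳ-≤ n z n (ℕₚ.≤-pred
              (≡.subst₂ ℕ._≤_ (ℕₚ.+-suc z n) (≡.cong (λ k → suc (n ℕ.+ k)) (ℕₚ.+-identityʳ n)) z+r≤m))

    -- Opaque: unfolding the basis search while comparing codes makes type checking very slow.
    opaque
      complete : ∀ {t} {P : Fin (suc (suc t)) → V m} → LinIndep F P → (∀ i → InSpan F (basis S) (P i)) →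
                 Σ (⟦ Completion t ⟧ q) λ w → CompletedBy t P w S
      complete {t} {P} indep P⊆S = (z , s≤s z≤dim , pivots , k , s≤s k≤n₁∸t , W) , spans ⊆S covers
        where
        open Extension (extend {B = P} indep X)
        W : Fin k → ⟦ Reduced z ⟧ q
        W κ = pick κ , index ∘ coeffs (pick κ)
        W≋X : ∀ κ → X (pick κ) ≋ reducedVector pivots (W κ)
        W≋X κ j = +-congˡ (-‿cong (lincomb-congʳ (δ ∘ pivots) (λ i → sym (enum-index (coeffs (pick κ) i))) j))
        k+t+2≤n+1 : k ℕ.+ suc (suc t) ℕ.≤ suc n
        k+t+2≤n+1 = steinitz {B = basis S} independent
                      (++-All (InSpan F (basis S)) (λ κ → reduced∈span (pick κ)) P⊆S)
        k≤n₁∸t : k ℕ.≤ n₁ ℕ.∸ t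
        k≤n₁∸t = ℕₚ.m+n≤o⇒m≤o∸n k (ℕₚ.≤-pred (ℕₚ.≤-pred
                   (≡.subst (ℕ._≤ suc n) (≡.trans (ℕₚ.+-suc k (suc t)) (≡.cong suc (ℕₚ.+-suc k t))) k+t+2≤n+1)))
        ⊆S : ∀ i → InSpan F (basis S) (((reducedVector pivots ∘ W) ++ P) i)
        ⊆S = ++-All (InSpan F (basis S)) (λ κ → InSpan-resp-≋ {B = basis S} (W≋X κ) (reduced∈span (pick κ))) P⊆S
        covers : ∀ i → InSpan F ((reducedVector pivots ∘ W) ++ P) (basis S i)
        covers i = InSpan-trans {U = (X ∘ pick) ++ P} (≋⇒InSpan (++-pointwise _≋_ W≋X (λ _ _ → refl)))
                     (InSpan-trans {U = X} spanning (span⊆reduced (InSpan-member (basis S) i)))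

    x : Fin N → ⟦ Normalised n₁ ⟧ q
    x i = proj₁ (meet-point {S} i (meets i))

    p : Fin N → V m
    p i = pointOn i (x i)

    p∈S : ∀ i → InSpan F (basis S) (p i)
    p∈S i = proj₂ (meet-point {S} i (meets i))

    independentCode : ∀ {t} (σ : Fin t → Fin N) → LinIndep F (p ∘ σ) → ¬ (∃ λ j → ∀ i → σ i ≢ j) →
                      Σ (⟦ Code ⟧ q) (Represents S)
    independentCode {t} σ indep σ-onto =
      inj₁ x , spans p∈S (λ i → InSpan-trans {B = p} {U = p ∘ σ} (InSpan-member p ∘ σ)
                                  (steinitz-spanning {B = basis S} indep (p∈S ∘ σ) n+1≤t i))
      where
      surjective : ∀ j → ∃ λ i → σ i ≡ j
      surjective j with Finₚ.any? (λ i → σ i Fin.≟ j)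
      ... | yes σi≡j = σi≡j
      ... | no  ∄i   = ⊥-elim (σ-onto (j , λ i σi≡j → ∄i (i , σi≡j)))
      n+1≤t : suc n ℕ.≤ t
      n+1≤t = ≡.subst (ℕ._≤ t) (ℕₚ.+-comm n 1) (Finₚ.injective⇒≤ {f = proj₁ ∘ surjective}
                λ {j} {j′} eq → ≡.trans (≡.sym (proj₂ (surjective j))) (≡.trans (≡.cong σ eq) (proj₂ (surjective j′))))

    replacementCode : ∀ {t} (σ : Fin (suc t) → Fin N) → LinIndep F (p ∘ σ) → ∀ j → (∀ i → σ i ≢ j) →
                    ∀ c → p j ≋ lincomb F (p ∘ σ) c → ∀ s → c s ≉ 0# → ¬ (∀ i → removeAt c s i ≈ 0#) →
                    Σ (⟦ Code ⟧ q) (Represents S)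
    replacementCode {zero} σ indep j σ≢j c pj≋ s cs≉0 rest≉0 = ⊥-elim (rest≉0 (λ ()))
    replacementCode {suc t} σ indep j σ≢j c pj≋ s cs≉0 rest≉0 =
      inj₂ (t , t<n , σ s , j , Pcode , coords , w) , σ≢j s , y , y∈A , y+u∈A , completes
      where
      open Normalisation (normalise (removeAt c s) rest≉0) renaming (scale to ν; scale≉0 to ν≉0)
      P = p ∘ σ
      μ = ν * c s
      y = μ ⊙ P s
      Pcode : Fin (suc t) → ⟦ Point ⟧ q
      Pcode i = σ (punchIn s i) , x (σ (punchIn s i))
      y∈A : InSpan F (basis (A (σ s))) y
      y∈A = InSpan-scale {B = basis (A (σ s))} μ (pointOn∈A (σ s) (x (σ s)))
      νpj≋ : ν ⊙ p j ≋ y ⊞ lincomb F (removeAt P s) (normalised coords)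
      νpj≋ k = begin
        ν * p j k
          ≈⟨ *-congˡ (trans (pj≋ k) (lincomb-removeAt P c s k)) ⟩
        ν * (c s * P s k + lincomb F (removeAt P s) (removeAt c s) k)
          ≈⟨ distribˡ ν _ _ ⟩
        ν * (c s * P s k) + ν * lincomb F (removeAt P s) (removeAt c s) k
          ≈⟨ +-cong (*-assoc ν (c s) (P s k)) (lincomb-scale (removeAt P s) ν (removeAt c s) k) ⟨
        μ * P s k + lincomb F (removeAt P s) (λ i → ν * removeAt c s i) k
          ≈⟨ +-congˡ (lincomb-congʳ (removeAt P s) coords≈ k) ⟨
        y k + lincomb F (removeAt P s) (normalised coords) k ∎
      y+u∈A : InSpan F (basis (A j)) (y ⊞ lincomb F (point ∘ Pcode) (normalised coords))
      y+u∈A = InSpan-resp-≋ {B = basis (A j)} νpj≋ (InSpan-scale {B = basis (A j)} ν (pointOn∈A j (x j)))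
      P′⊆S : ∀ i → InSpan F (basis S) ((y ∷ removeAt P s) i)
      P′⊆S zero    = InSpan-scale {B = basis S} μ (p∈S (σ s))
      P′⊆S (suc i) = p∈S (σ (punchIn s i))
      P′-indep : LinIndep F (y ∷ removeAt P s)
      P′-indep = LinIndep-replace {B = P} indep s (x*y≉0 ν≉0 cs≉0)
      t<n : t ℕ.< n
      t<n = ℕₚ.≤-pred (steinitz {B = basis S} P′-indep P′⊆S)
      w : ⟦ Completion t ⟧ q
      w = proj₁ (complete P′-indep P′⊆S)
      completes : CompletedBy t (y ∷ removeAt P s) w S
      completes = proj₂ (complete P′-indep P′⊆S)

    dependentCode : ∀ {t} (σ : Fin t → Fin N) → LinIndep F (p ∘ σ) → ∀ j → (∀ i → σ i ≢ j) →
                    InSpan F (p ∘ σ) (p j) → Σ (⟦ Code ⟧ q) (Represents S)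
    dependentCode {zero} σ indep j σ≢j (c , pj≋) =
      ⊥-elim (pointOn≉0 j (x j) (λ k → trans (pj≋ k) (lincomb-zero (p ∘ σ) {c} (λ ()) k)))
    dependentCode {suc t} σ indep j σ≢j (c , pj≋) = replacementCode σ indep j σ≢j c pj≋ s cs≉0 rest≉0
      where
      s,cs≉0 = nonzero-entry c λ c≈0 → pointOn≉0 j (x j) (λ k → trans (pj≋ k) (lincomb-zero (p ∘ σ) c≈0 k))
      s = proj₁ s,cs≉0
      cs≉0 = proj₂ s,cs≉0
      rest≉0 : ¬ (∀ i → removeAt c s i ≈ 0#)
      rest≉0 rest≈0 = skew (σ s) j (σ≢j s) (p j , pointOn≉0 j (x j) , pj∈Aσs , pointOn∈A j (x j))
        where
        pj≈ : c s ⊙ p (σ s) ≋ p j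
        pj≈ k = sym (begin
          p j k                                                                    ≈⟨ pj≋ k ⟩
          lincomb F (p ∘ σ) c k                                                    ≈⟨ lincomb-removeAt (p ∘ σ) c s k ⟩
          c s * p (σ s) k + lincomb F (removeAt (p ∘ σ) s) (removeAt c s) k        ≈⟨ +-congˡ (lincomb-zero (removeAt (p ∘ σ) s) rest≈0 k) ⟩
          c s * p (σ s) k + 0#                                                     ≈⟨ +-identityʳ _ ⟩
          c s * p (σ s) k                                                          ∎)
        pj∈Aσs : InSpan F (basis (A (σ s))) (p j)
        pj∈Aσs = InSpan-resp-≋ {B = basis (A (σ s))} pj≈ (InSpan-scale {B = basis (A (σ s))} (c s) (pointOn∈A (σ s) (x (σ s))))

    codeFor : ∀ {t} (σ : Fin t → Fin N) → LinIndep F (p ∘ σ) → (∀ j → InSpan F (p ∘ σ) (p j)) →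
              Σ (⟦ Code ⟧ q) (Represents S)
    codeFor σ indep spanning with Finₚ.any? (λ j → Finₚ.all? (λ i → ¬? (σ i Fin.≟ j)))
    ... | yes (j , σ≢j) = dependentCode σ indep j σ≢j (spanning j)
    ... | no  σ-onto    = independentCode σ indep σ-onto

    -- Opaque for the same reason as complete.
    opaque
      code : Σ (⟦ Code ⟧ q) (Represents S)
      code = let (_ , σ , indep , spanning) = independent-subfamily p in codeFor σ indep spanning

  length≤card : (L : List Space) → AllPairs (λ S T → ¬ SameSpace F S T) L →
                All.All (λ S → ∀ i → Meets F S (A i)) L → length L ℕ.≤ card q Code
  length≤card L distinct meets = Finₚ.injective⇒≤ codeAt-injective
    where
    represented : ∀ i → Σ (⟦ Code ⟧ q) (Represents (List.lookup L i))
    represented i = Encoding.code (List.lookup L i) (All.lookup meets (∈-lookup i))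
    codeAt : Fin (length L) → Fin (card q Code)
    codeAt i = encode Code (proj₁ (represented i))
    same : ∀ {i j} → codeAt i ≡ codeAt j → SameSpace F (List.lookup L i) (List.lookup L j)
    same {i} {j} eq = Represents-unique cᵢ cⱼ (proj₂ (represented i)) (proj₂ (represented j)) (encode-injective Code {cᵢ} {cⱼ} eq)
      where
      cᵢ = proj₁ (represented i)
      cⱼ = proj₁ (represented j)
    codeAt-injective : ∀ {i j} → codeAt i ≡ codeAt j → i ≡ j
    codeAt-injective {i} {j} eq with Finₚ.<-cmp i j
    ... | tri< i<j _ _ = ⊥-elim (AllPairs-lookup distinct i<j (same eq))
    ... | tri≈ _ i≡j _ = i≡j
    ... | tri> _ _ j<i = ⊥-elim (AllPairs-lookup distinct j<i (swap ∘ same eq))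

open import Data.Nat using (ℕ; _+_; _*_; _∸_; _^_; _≤_; _<_)
open import Data.Fin using (Fin)
open import Data.List using (List; length)
open import Data.List.Relation.Unary.All using (All)
open import Data.List.Relation.Unary.AllPairs using (AllPairs)
open import Data.Product using (Σ; _×_)
open import Relation.Nullary using (¬_)
open import Relation.Binary.PropositionalEquality using (_≢_)

lemma5 : (n : ℕ) → 2 ≤ n →
    Σ ℕ λ C → 0 < C ×
      ((F : FiniteField) →
       (A : Fin (n + 1) → ProjSubspace F (2 * n) (n ∸ 1)) →
       (∀ i j → i ≢ j → Skew F (A i) (A j)) →
       (L : List (ProjSubspace F (2 * n) n)) →
       AllPairs (λ S T → ¬ SameSpace F S T) L →
       All (λ S → ∀ i → Meets F S (A i)) L →
       length L ≤ C * FiniteField.size F ^ (n * n ∸ 1))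
lemma5 zero ()
lemma5 (suc n₁) _ = suc (card 1 Code) , s≤s z≤n , bound
  where
  open CodeShapes n₁
  open ℕₚ.≤-Reasoning
  bound : (F : FiniteField) (A : Fin N → ProjSubspace F (2 * n) n₁) → (∀ i j → i ≢ j → Skew F (A i) (A j)) →
          (L : List (ProjSubspace F (2 * n) n)) → AllPairs (λ S T → ¬ SameSpace F S T) L →
          All (λ S → ∀ i → Meets F S (A i)) L → length L ≤ suc (card 1 Code) * FiniteField.size F ^ (n₁ + n₁ * n)
  bound F A skew L distinct meets = begin
    length L                        ≤⟨ Geometry.length≤card F n₁ A skew L distinct meets ⟩
    card q Code                     ≤⟨ card≤card₁*q^ q {{q≢0}} Code degree-Code ⟩
    card 1 Code * q ^ E             ≤⟨ ℕₚ.*-monoˡ-≤ (q ^ E) (ℕₚ.n≤1+n (card 1 Code)) ⟩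
    suc (card 1 Code) * q ^ E       ∎
    where
    q = FiniteField.size F
    E = n₁ + n₁ * n
    q≢0 : ℕ.NonZero q
    q≢0 = ℕ.>-nonZero (ℕₚ.<-trans (s≤s z≤n) (LinearAlgebra.1<size F))
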